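{- Let $\mathcal S\subseteq\{ -1,0,1\}^3\setminus\{(0,0,0)\}$. Then $\mathcal S$ contains an unused step if and only if one of the following conditions holds: $(A_x)$: $\mathcal S$ contains a step with first coordinate $-1$ but no step with first coordinate $+1$; $(B)$: $\mathcal S$ is non-empty and each step of $\mathcal S$ has a negative coordinate; $(C_z)$: $(0,0,1)\in\mathcal S$, every step $(i,j,k)\in\mathcal S$ satisfies $i+j\le 0$, and $\mathcal S\not\subseteq\{(0,0,1),(0,0,-1)\}$; $(D)$: there is a permutation of the coordinates which, applied to $\mathcal S$, yields a step set satisfying $(A_x)$ or $(C_z)$. Moreover, in case $(A_x)$ every step with first coordinate $-1$ is unused; in case $(B)$ all steps are unused; in case $(C_z)$ all steps with a negative first or second coordinate are unused.
   Context: An $\mathcal S$-walk is a finite sequence of steps of $\mathcal S$ starting at the origin; it is confined to the octant if all its visited points lie in $\mathbb N^3$. A step $s\in\mathcal S$ is unused if no $\mathcal S$-walk confined to the octant $\mathbb N^3$ contains the step $s$. -}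

module Defs where

open import Data.Integer using (ℤ; _+_; _≤_; _<_; 0ℤ; 1ℤ; -1ℤ)
open import Data.Fin using (Fin; zero; suc)
open import Data.Fin.Permutation using (Permutation′; _⟨$⟩ʳ_)
open import Data.Product using (_×_; _,_; Σ; ∃; proj₁; proj₂)
open import Data.Sum using (_⊎_)
open import Data.List using (List; []; _∷_; map)
open import Data.List.Relation.Unary.All using (All)
open import Data.List.Membership.Propositional using (_∈_)
open import Relation.Binary.PropositionalEquality using (_≡_; _≢_)
open import Relation.Nullary using (¬_)

Point : Set
Point = ℤ × ℤ × ℤ

origin : Point
origin = 0ℤ , 0ℤ , 0ℤ

xc yc zc : Point → ℤ
xc (x , _ , _) = x
yc (_ , y , _) = y
zc (_ , _ , z) = z

_⊕_ : Point → Point → Point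
(a , b , c) ⊕ (d , e , f) = (a + d) , (b + e) , (c + f)

data Unit3 : ℤ → Set where
  m1 : Unit3 -1ℤ
  z0 : Unit3 0ℤ
  p1 : Unit3 1ℤ

IsStep : Point → Set
IsStep s = Unit3 (xc s) × Unit3 (yc s) × Unit3 (zc s) × s ≢ origin

InOctant : Point → Set
InOctant p = (0ℤ ≤ xc p) × (0ℤ ≤ yc p) × (0ℤ ≤ zc p)

positions : Point → List Point → List Point
positions p []      = p ∷ []
positions p (s ∷ w) = p ∷ positions (p ⊕ s) w

IsWalk : List Point → List Point → Set
IsWalk S w = All (_∈ S) w

Confined : List Point → Set
Confined w = All InOctant (positions origin w)

Unused : List Point → Point → Set
Unused S s = ¬ (Σ (List Point) λ w → IsWalk S w × Confined w × s ∈ w)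

ContainsUnused : List Point → Set
ContainsUnused S = ∃ λ s → s ∈ S × Unused S s

CondAx : List Point → Set
CondAx S = (∃ λ s → s ∈ S × xc s ≡ -1ℤ) × (∀ s → s ∈ S → xc s ≢ 1ℤ)

HasNegCoord : Point → Set
HasNegCoord s = (xc s < 0ℤ) ⊎ (yc s < 0ℤ) ⊎ (zc s < 0ℤ)

CondB : List Point → Set
CondB S = (∃ λ s → s ∈ S) × (∀ s → s ∈ S → HasNegCoord s)

CondCz : List Point → Set
CondCz S = ((0ℤ , 0ℤ , 1ℤ) ∈ S)
         × (∀ s → s ∈ S → xc s + yc s ≤ 0ℤ)
         × ¬ (∀ s → s ∈ S → (s ≡ (0ℤ , 0ℤ , 1ℤ)) ⊎ (s ≡ (0ℤ , 0ℤ , -1ℤ)))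

-- permuting coordinates: new coordinate i is old coordinate σ(i)
coord : Point → Fin 3 → ℤ
coord p zero             = xc p
coord p (suc zero)       = yc p
coord p (suc (suc zero)) = zc p

permute : Permutation′ 3 → Point → Point
permute σ p = coord p (σ ⟨$⟩ʳ zero) , coord p (σ ⟨$⟩ʳ suc zero) , coord p (σ ⟨$⟩ʳ suc (suc zero))

CondD : List Point → Set
CondD S = ∃ λ (σ : Permutation′ 3) → CondAx (map (permute σ) S) ⊎ CondCz (map (permute σ) S)

module Submission where

-- Call a set I of coordinates frozen for S
-- if every step of S that is nonnegative on I is zero on I.  A confined walk
-- then never leaves the face {p | p_i = 0 for i ∈ I}, so every step that is
-- negative on some coordinate of I is unused (frozenUnused).  Conditions
-- (A_x), (B) and (C_z) say that {x}, {x,y,z} and {x,y} are frozen, and (D) is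
-- (A) or (C) for permuted coordinates, which is handled by stating the A- and
-- C-arguments for arbitrary coordinates.
--
-- A set κ of coordinates is unbounded if the
-- reachable points of ℕ³ are arbitrarily large in all coordinates of κ
-- simultaneously.  A step that lowers only coordinates of κ can be repeated
-- any number of times, so the coordinates it raises may be added to κ;
-- starting from κ = ∅ this stops after at most three rounds with a closed κ
-- (closed-unbounded).  If every step lowers only coordinates of κ, every step
-- is used.  Otherwise closedness says that a step raising a coordinate outside
-- κ lowers another one outside κ, and a split on the size of κ gives (B) for
-- κ = ∅, (C) after a permutation for κ = {j} (the first step of a walk
-- leaving the origin is then e_j), and (A) after a permutation for |κ| = 2.

open import Defs
open import Data.Integer using (_<_; 0ℤ; -1ℤ)
open import Data.Product using (_×_)
open import Data.Sum using (_⊎_)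
open import Data.List using (List)
open import Data.List.Relation.Unary.All using (All)
open import Data.List.Membership.Propositional using (_∈_)
open import Relation.Binary.PropositionalEquality using (_≡_)
open import Function.Bundles using (_⇔_)

open import Data.Integer as ℤ using (ℤ; +_; 1ℤ; _≤_; +≤+; -<+)
import Data.Integer.Properties as ℤP
open import Data.Nat as ℕ using (ℕ; zero; suc; z≤n; s≤s)
import Data.Nat.Properties as ℕP
open import Data.Bool using (Bool; true; false; _∨_)
import Data.Bool as Bool
import Data.Bool.Properties as BoolP
open import Data.Fin using (Fin)
import Data.Fin.Properties as FinP
open import Data.Fin.Permutation using (Permutation′; _⟨$⟩ʳ_; _⟨$⟩ˡ_; inverseʳ; transpose)
import Data.Fin.Permutation as Perm
open import Data.Product using (Σ; ∃; _,_; proj₁; proj₂)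
open import Data.Sum using (inj₁; inj₂; [_,_]′; swap)
open import Data.List using ([]; _∷_; _∷ʳ_; map; foldl)
open import Data.List.Properties using (foldl-∷ʳ)
import Data.List.Relation.Unary.All as All
open import Data.List.Relation.Unary.All using ([]; _∷_)
import Data.List.Relation.Unary.All.Properties as AllP
open import Data.List.Relation.Unary.Any using (here; there; any?)
open import Data.List.Membership.Propositional using (find; lose)
open import Data.List.Membership.Propositional.Properties using (∈-map⁺; ∈-map⁻; ∈-++⁺ʳ)
open import Data.Empty using (⊥; ⊥-elim)
open import Data.Unit using (⊤; tt)
open import Relation.Nullary using (¬_; yes; no)
open import Relation.Nullary.Decidable using (_×-dec_; _⊎-dec_; _→-dec_)
open import Relation.Unary using (Decidable)
open import Relation.Binary.PropositionalEquality using (_≢_; refl; sym; trans; cong; cong₂; subst)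
open import Function.Bundles using (mk⇔)

pattern x̂ = Fin.zero
pattern ŷ = Fin.suc Fin.zero
pattern ẑ = Fin.suc (Fin.suc Fin.zero)

coord-⊕ : ∀ p t i → coord (p ⊕ t) i ≡ coord p i ℤ.+ coord t i
coord-⊕ p t x̂ = refl
coord-⊕ p t ŷ = refl
coord-⊕ p t ẑ = refl

coord-origin : ∀ i → coord origin i ≡ 0ℤ
coord-origin x̂ = refl
coord-origin ŷ = refl
coord-origin ẑ = refl

point-ext : ∀ (p : Point) {x y z} → xc p ≡ x → yc p ≡ y → zc p ≡ z → p ≡ (x , y , z)
point-ext p refl refl refl = refl

coord-from-zero : ∀ p t i → coord p i ≡ 0ℤ → coord (p ⊕ t) i ≡ coord t i
coord-from-zero p t i p₀ = trans (coord-⊕ p t i) (trans (cong (ℤ._+ coord t i) p₀) (ℤP.+-identityˡ _))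

inOctant-coord : ∀ {q} → InOctant q → ∀ i → 0ℤ ≤ coord q i
inOctant-coord (a , b , c) x̂ = a
inOctant-coord (a , b , c) ŷ = b
inOctant-coord (a , b , c) ẑ = c

Lowers Raises : Point → Fin 3 → Set
Lowers t i = coord t i ≡ -1ℤ
Raises t i = coord t i ≡ 1ℤ

step-units : ∀ {t} → IsStep t → ∀ i → Unit3 (coord t i)
step-units (ux , uy , uz , _) x̂ = ux
step-units (ux , uy , uz , _) ŷ = uy
step-units (ux , uy , uz , _) ẑ = uz

step-nonzero : ∀ {t} → IsStep t → t ≢ origin
step-nonzero (_ , _ , _ , t≢0) = t≢0

HasNegCoord-at : ∀ {t} i → coord t i < 0ℤ → HasNegCoord t
HasNegCoord-at x̂ neg = inj₁ neg
HasNegCoord-at ŷ neg = inj₂ (inj₁ neg)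
HasNegCoord-at ẑ neg = inj₂ (inj₂ neg)

negative-coord : ∀ {t} → HasNegCoord t → Σ (Fin 3) λ i → coord t i < 0ℤ
negative-coord (inj₁ neg)         = x̂ , neg
negative-coord (inj₂ (inj₁ neg))  = ŷ , neg
negative-coord (inj₂ (inj₂ neg))  = ẑ , neg

-1<0 : -1ℤ < 0ℤ
-1<0 = -<+

-1≢1 : -1ℤ ≢ 1ℤ
-1≢1 ()

-1≢0 : -1ℤ ≢ 0ℤ
-1≢0 ()

unit-zero : ∀ {z} → Unit3 z → z ≢ -1ℤ → z ≢ 1ℤ → z ≡ 0ℤ
unit-zero m1 ≢-1 _  = ⊥-elim (≢-1 refl)
unit-zero z0 _   _  = refl
unit-zero p1 _   ≢1 = ⊥-elim (≢1 refl)

unit-one : ∀ {z} → Unit3 z → z ≢ -1ℤ → z ≢ 0ℤ → z ≡ 1ℤ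
unit-one m1 ≢-1 _  = ⊥-elim (≢-1 refl)
unit-one z0 _   ≢0 = ⊥-elim (≢0 refl)
unit-one p1 _   _  = refl

unit-nonneg-zero : ∀ {z} → Unit3 z → z ≢ 1ℤ → 0ℤ ≤ z → z ≡ 0ℤ
unit-nonneg-zero z0 _  _ = refl
unit-nonneg-zero p1 ≢1 _ = ⊥-elim (≢1 refl)

nonneg-sum-zero : ∀ {x y} → 0ℤ ≤ x → 0ℤ ≤ y → x ℤ.+ y ≤ 0ℤ → (x ≡ 0ℤ) × (y ≡ 0ℤ)
nonneg-sum-zero {+ m} {+ n} _ _ (+≤+ m+n≤0) =
  cong +_ (ℕP.m+n≡0⇒m≡0 m m+n≡0) , cong +_ (ℕP.m+n≡0⇒n≡0 m m+n≡0)
  where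
  m+n≡0 : m ℕ.+ n ≡ 0
  m+n≡0 = ℕP.n≤0⇒n≡0 m+n≤0

unit-pair-sum : ∀ {x y} → Unit3 x → Unit3 y → (x ≡ 1ℤ → y ≡ -1ℤ) → (y ≡ 1ℤ → x ≡ -1ℤ)
              → x ℤ.+ y ≤ 0ℤ
unit-pair-sum m1 m1 _ _ = ℤ.-≤+
unit-pair-sum m1 z0 _ _ = ℤ.-≤+
unit-pair-sum m1 p1 _ _ = +≤+ z≤n
unit-pair-sum z0 m1 _ _ = ℤ.-≤+
unit-pair-sum z0 z0 _ _ = +≤+ z≤n
unit-pair-sum z0 p1 _ y⇒x with y⇒x refl
... | ()
unit-pair-sum p1 m1 _ _ = +≤+ z≤n
unit-pair-sum p1 z0 x⇒y _ with x⇒y refl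
... | ()
unit-pair-sum p1 p1 x⇒y _ with x⇒y refl
... | ()

permute-coord : ∀ σ p i → coord (permute σ p) i ≡ coord p (σ ⟨$⟩ʳ i)
permute-coord σ p x̂ = refl
permute-coord σ p ŷ = refl
permute-coord σ p ẑ = refl

permute-cover : ∀ (σ : Permutation′ 3) i → (i ≡ σ ⟨$⟩ʳ x̂) ⊎ (i ≡ σ ⟨$⟩ʳ ŷ) ⊎ (i ≡ σ ⟨$⟩ʳ ẑ)
permute-cover σ i with σ ⟨$⟩ˡ i in eq
... | x̂ = inj₁ (trans (sym (inverseʳ σ)) (cong (σ ⟨$⟩ʳ_) eq))
... | ŷ = inj₂ (inj₁ (trans (sym (inverseʳ σ)) (cong (σ ⟨$⟩ʳ_) eq)))
... | ẑ = inj₂ (inj₂ (trans (sym (inverseʳ σ)) (cong (σ ⟨$⟩ʳ_) eq)))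

permute-step : ∀ σ {s} → IsStep s → IsStep (permute σ s)
permute-step σ {s} st =
  step-units st (σ ⟨$⟩ʳ x̂) , step-units st (σ ⟨$⟩ʳ ŷ) , step-units st (σ ⟨$⟩ʳ ẑ) , nonzero
  where
  nonzero : permute σ s ≢ origin
  nonzero eq = step-nonzero st (point-ext s (zero-at x̂) (zero-at ŷ) (zero-at ẑ))
    where
    zero-at : ∀ i → coord s i ≡ 0ℤ
    zero-at i = [ at x̂ , [ at ŷ , at ẑ ]′ ]′ (permute-cover σ i)
      where
      at : ∀ k → i ≡ σ ⟨$⟩ʳ k → coord s i ≡ 0ℤ
      at k refl = trans (sym (permute-coord σ s k)) (trans (cong (λ q → coord q k) eq) (coord-origin k))

∀-map⁺ : ∀ {P : Point → Set} (f : Point → Point) {L} → (∀ t → t ∈ L → P (f t)) → ∀ t → t ∈ map f L → P t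
∀-map⁺ f h t t∈fL with ∈-map⁻ f t∈fL
... | s , s∈L , refl = h s s∈L

∀-map⁻ : ∀ {P : Point → Set} (f : Point → Point) {L} → (∀ t → t ∈ map f L → P t) → ∀ t → t ∈ L → P (f t)
∀-map⁻ f h t t∈L = h (f t) (∈-map⁺ f t∈L)

search : {P : Point → Set} → Decidable P → ∀ L → (∃ λ t → t ∈ L × P t) ⊎ (∀ t → t ∈ L → ¬ P t)
search P? L with any? P? L
... | yes found = inj₁ (find found)
... | no none   = inj₂ λ t t∈L pt → none (lose t∈L pt)

-- Frozen coordinates: the sufficient conditions for unused steps.

positions-head : ∀ {P : Point → Set} q w → All P (positions q w) → P q
positions-head q []      (h ∷ _) = h
positions-head q (_ ∷ _) (h ∷ _) = h

FrozenOn : (Fin 3 → Set) → List Point → Set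
FrozenOn I S = ∀ t → t ∈ S → (∀ i → I i → 0ℤ ≤ coord t i) → ∀ i → I i → coord t i ≡ 0ℤ

-- Confined walks stay on the face where the frozen coordinates vanish, so a
-- step that is negative on a frozen coordinate never occurs.
frozenUnused : ∀ {I S} → FrozenOn I S → ∀ s i → I i → coord s i < 0ℤ → Unused S s
frozenUnused {I} {S} frozen s i Ii s<0 (w , walk , confined , s∈w) =
  walk-stays origin w (λ j _ → coord-origin j) walk confined s∈w
  where
  OnFace : Point → Set
  OnFace p = ∀ j → I j → coord p j ≡ 0ℤ

  walk-stays : ∀ p w → OnFace p → IsWalk S w → All InOctant (positions p w) → s ∈ w → ⊥
  walk-stays p (t ∷ w) face _ (_ ∷ conf) (here refl) =
    ℤP.<⇒≱ s<0 (subst (0ℤ ≤_) (coord-from-zero p s i (face i Ii)) (inOctant-coord (positions-head _ w conf) i))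
  walk-stays p (t ∷ w) face (t∈S ∷ walk) (_ ∷ conf) (there s∈w) =
    walk-stays (p ⊕ t) w face′ walk conf s∈w
    where
    t-nonneg : ∀ j → I j → 0ℤ ≤ coord t j
    t-nonneg j Ij = subst (0ℤ ≤_) (coord-from-zero p t j (face j Ij)) (inOctant-coord (positions-head _ w conf) j)
    face′ : OnFace (p ⊕ t)
    face′ j Ij = trans (coord-from-zero p t j (face j Ij)) (frozen t t∈S t-nonneg j Ij)

-- Condition (A) in coordinate i: no step increases i, so {i} is frozen.
axUnused : ∀ {S} → All IsStep S → ∀ i → (∀ t → t ∈ S → ¬ Raises t i)
         → ∀ s → Lowers s i → Unused S s
axUnused steps i no-raise s s-1 =
  frozenUnused frozen s i refl (subst (_< 0ℤ) (sym s-1) -1<0)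
  where
  frozen : FrozenOn (_≡ i) _
  frozen t t∈S t-nonneg .i refl =
    unit-nonneg-zero (step-units (All.lookup steps t∈S) i) (no-raise t t∈S) (t-nonneg i refl)

frozen-pair : ∀ {S} a b → (∀ t → t ∈ S → coord t a ℤ.+ coord t b ≤ 0ℤ)
            → FrozenOn (λ j → (j ≡ a) ⊎ (j ≡ b)) S
frozen-pair a b sum≤0 t t∈S t-nonneg j j∈ab = [ (λ { refl → proj₁ ab₀ }) , (λ { refl → proj₂ ab₀ }) ]′ j∈ab
  where
  ab₀ : (coord t a ≡ 0ℤ) × (coord t b ≡ 0ℤ)
  ab₀ = nonneg-sum-zero (t-nonneg a (inj₁ refl)) (t-nonneg b (inj₂ refl)) (sum≤0 t t∈S)

czUnused : ∀ {S} a b → (∀ t → t ∈ S → coord t a ℤ.+ coord t b ≤ 0ℤ)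
         → ∀ s → (coord s a < 0ℤ) ⊎ (coord s b < 0ℤ) → Unused S s
czUnused a b sum≤0 s (inj₁ sa<0) = frozenUnused (frozen-pair a b sum≤0) s a (inj₁ refl) sa<0
czUnused a b sum≤0 s (inj₂ sb<0) = frozenUnused (frozen-pair a b sum≤0) s b (inj₂ refl) sb<0

-- Condition (B): every step has a negative coordinate, so all coordinates are frozen.
bUnused : ∀ {S} → (∀ t → t ∈ S → HasNegCoord t) → ∀ s → s ∈ S → Unused S s
bUnused {S} neg s s∈S = frozenUnused frozen s (proj₁ s<0) tt (proj₂ s<0)
  where
  s<0 : Σ (Fin 3) λ i → coord s i < 0ℤ
  s<0 = negative-coord (neg s s∈S)
  frozen : FrozenOn (λ _ → ⊤) S
  frozen t t∈S t-nonneg = ⊥-elim (ℤP.<⇒≱ (proj₂ t<0) (t-nonneg (proj₁ t<0) tt))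
    where
    t<0 : Σ (Fin 3) λ i → coord t i < 0ℤ
    t<0 = negative-coord (neg t t∈S)

vertical-step : ∀ {t} → IsStep t → xc t ≡ 0ℤ → yc t ≡ 0ℤ
              → (t ≡ (0ℤ , 0ℤ , 1ℤ)) ⊎ (t ≡ (0ℤ , 0ℤ , -1ℤ))
vertical-step {_ , _ , _} (_ , _ , m1 , _)   refl refl = inj₂ refl
vertical-step {_ , _ , _} (_ , _ , z0 , t≢0) refl refl = ⊥-elim (t≢0 refl)
vertical-step {_ , _ , _} (_ , _ , p1 , _)   refl refl = inj₁ refl

on-axis-xy : ∀ {t} → (t ≡ (0ℤ , 0ℤ , 1ℤ)) ⊎ (t ≡ (0ℤ , 0ℤ , -1ℤ)) → (xc t ≡ 0ℤ) × (yc t ≡ 0ℤ)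
on-axis-xy (inj₁ refl) = refl , refl
on-axis-xy (inj₂ refl) = refl , refl

-- Under (C_z) some step is off the z-axis, hence has a negative x or y coordinate.
cz-negative-step : ∀ {L} → All IsStep L → CondCz L → ∃ λ t → t ∈ L × ((xc t < 0ℤ) ⊎ (yc t < 0ℤ))
cz-negative-step {L} steps (_ , sum≤0 , off-axis)
  with search (λ t → (xc t ℤ.<? 0ℤ) ⊎-dec (yc t ℤ.<? 0ℤ)) L
... | inj₁ found = found
... | inj₂ none  = ⊥-elim (off-axis on-axis)
  where
  on-axis : ∀ t → t ∈ L → (t ≡ (0ℤ , 0ℤ , 1ℤ)) ⊎ (t ≡ (0ℤ , 0ℤ , -1ℤ))
  on-axis t t∈L = vertical-step (All.lookup steps t∈L) (proj₁ xy₀) (proj₂ xy₀)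
    where
    xy₀ : (xc t ≡ 0ℤ) × (yc t ≡ 0ℤ)
    xy₀ = nonneg-sum-zero (ℤP.≮⇒≥ λ x<0 → none t t∈L (inj₁ x<0))
                          (ℤP.≮⇒≥ λ y<0 → none t t∈L (inj₂ y<0))
                          (sum≤0 t t∈L)

Conditions : List Point → Set
Conditions S = CondAx S ⊎ CondB S ⊎ CondCz S ⊎ CondD S

-- Each condition yields an unused step: (A), (B), (C) directly, and (D) by
-- running the (A)/(C) argument in the permuted coordinates σ(x), σ(y).
conditions⇒unused : ∀ {S} → All IsStep S → Conditions S → ContainsUnused S
conditions⇒unused steps (inj₁ ((s , s∈S , s-1) , no-raise)) =
  s , s∈S , axUnused steps x̂ no-raise s s-1
conditions⇒unused steps (inj₂ (inj₁ ((s , s∈S) , neg))) =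
  s , s∈S , bUnused neg s s∈S
conditions⇒unused steps (inj₂ (inj₂ (inj₁ cz))) with cz-negative-step steps cz
... | s , s∈S , s<0 = s , s∈S , czUnused x̂ ŷ (proj₁ (proj₂ cz)) s s<0
conditions⇒unused steps (inj₂ (inj₂ (inj₂ (σ , inj₁ ((s′ , s′∈σS , s′-1) , no-raise)))))
  with ∈-map⁻ (permute σ) s′∈σS
... | s , s∈S , refl =
  s , s∈S , axUnused steps (σ ⟨$⟩ʳ x̂) (∀-map⁻ (permute σ) no-raise) s s′-1
conditions⇒unused steps (inj₂ (inj₂ (inj₂ (σ , inj₂ cz))))
  with cz-negative-step (AllP.map⁺ (All.map (permute-step σ) steps)) cz
... | s′ , s′∈σS , s′<0 with ∈-map⁻ (permute σ) s′∈σS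
...   | s , s∈S , refl =
  s , s∈S , czUnused (σ ⟨$⟩ʳ x̂) (σ ⟨$⟩ʳ ŷ) (∀-map⁻ (permute σ) (proj₁ (proj₂ cz))) s s′<0

ℕ³ : Set
ℕ³ = Fin 3 → ℕ

toPoint : ℕ³ → Point
toPoint v = + v x̂ , + v ŷ , + v ẑ

coord-toPoint : ∀ v i → coord (toPoint v) i ≡ + v i
coord-toPoint v x̂ = refl
coord-toPoint v ŷ = refl
coord-toPoint v ẑ = refl

toPoint-inOctant : ∀ v → InOctant (toPoint v)
toPoint-inOctant v = +≤+ z≤n , +≤+ z≤n , +≤+ z≤n

-- Adding a value in {-1,0,1} to a natural number (truncated at 0).
add-unit : ℕ → ∀ {z} → Unit3 z → ℕ
add-unit n m1 = ℕ.pred n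
add-unit n z0 = n
add-unit n p1 = suc n

add-unit-exact : ∀ n {z} (u : Unit3 z) → (z ≡ -1ℤ → 1 ℕ.≤ n) → + n ℤ.+ z ≡ + add-unit n u
add-unit-exact zero    m1 positive with positive refl
... | ()
add-unit-exact (suc n) m1 _ = refl
add-unit-exact n       z0 _ = cong +_ (ℕP.+-identityʳ n)
add-unit-exact n       p1 _ = cong +_ (ℕP.+-comm n 1)

add-unit-≥ : ∀ n {z} (u : Unit3 z) → ℕ.pred n ℕ.≤ add-unit n u
add-unit-≥ n m1 = ℕP.≤-refl
add-unit-≥ n z0 = ℕP.pred[n]≤n
add-unit-≥ n p1 = ℕP.≤-trans ℕP.pred[n]≤n (ℕP.n≤1+n n)

add-unit-one : ∀ n {z} (u : Unit3 z) → z ≡ 1ℤ → add-unit n u ≡ suc n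
add-unit-one n p1 refl = refl

move : ∀ {t} → IsStep t → ℕ³ → ℕ³
move st v i = add-unit (v i) (step-units st i)

move-⊕ : ∀ {t} (st : IsStep t) v → (∀ i → Lowers t i → 1 ℕ.≤ v i) → toPoint v ⊕ t ≡ toPoint (move st v)
move-⊕ {t} st v positive =
  cong₂ _,_ (exact x̂) (cong₂ _,_ (exact ŷ) (exact ẑ))
  where
  exact : ∀ i → + v i ℤ.+ coord t i ≡ + move st v i
  exact i = add-unit-exact (v i) (step-units st i) (positive i)

module Walks (S : List Point) where

  Reaches : List Point → Point → Set
  Reaches w p = IsWalk S w × Confined w × foldl _⊕_ origin w ≡ p

  Reachable : Point → Set
  Reachable p = Σ (List Point) λ w → Reaches w p

  confined-snoc : ∀ q w t → All InOctant (positions q w) → InOctant (foldl _⊕_ q w ⊕ t)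
                → All InOctant (positions q (w ∷ʳ t))
  confined-snoc q []      t (inside ∷ []) last = inside ∷ last ∷ []
  confined-snoc q (u ∷ w) t (inside ∷ rest) last = inside ∷ confined-snoc (q ⊕ u) w t rest last

  extend : ∀ {w p t} → Reaches w p → t ∈ S → InOctant (p ⊕ t) → Reaches (w ∷ʳ t) (p ⊕ t)
  extend {w} {t = t} (walk , confined , refl) t∈S inside =
    AllP.++⁺ walk (t∈S ∷ []) , confined-snoc origin w t confined inside , foldl-∷ʳ _⊕_ origin t w

  used : ∀ {p s} → Reachable p → s ∈ S → InOctant (p ⊕ s) → ¬ Unused S s
  used {s = s} (w , reaches) s∈S inside unused with extend reaches s∈S inside
  ... | walk , confined , _ = unused (w ∷ʳ s , walk , confined , ∈-++⁺ʳ w (here refl))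

  reach-move : ∀ {v t} → Reachable (toPoint v) → t ∈ S → (st : IsStep t)
             → (∀ i → Lowers t i → 1 ℕ.≤ v i) → Reachable (toPoint (move st v))
  reach-move {v} (w , reaches) t∈S st positive =
    subst Reachable (move-⊕ st v positive)
      (w ∷ʳ _ , extend reaches t∈S (subst InOctant (sym (move-⊕ st v positive)) (toPoint-inOctant (move st v))))

  leaves-origin : ∀ {p} → Reachable p → p ≢ origin → ∃ λ t → t ∈ S × (∀ i → ¬ Lowers t i)
  leaves-origin ([]    , _ , _ , refl) p≢0 = ⊥-elim (p≢0 refl)
  leaves-origin (t ∷ w , t∈S ∷ _ , _ ∷ confined , _) _ = t , t∈S , not-lowering
    where
    not-lowering : ∀ i → ¬ Lowers t i
    not-lowering i t-1 = ℤP.<⇒≱ -1<0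
      (subst (0ℤ ≤_) (trans (coord-from-zero origin t i (coord-origin i)) t-1)
             (inOctant-coord (positions-head _ w confined) i))

CoordSet : Set
CoordSet = Fin 3 → Bool

_∪_ : CoordSet → CoordSet → CoordSet
(κ ∪ ρ) i = κ i ∨ ρ i

false≢true : ∀ {b} → b ≡ false → b ≡ true → ⊥
false≢true refl ()

∪-member : ∀ κ ρ i → (κ ∪ ρ) i ≡ true → (κ i ≡ true) ⊎ (ρ i ≡ true)
∪-member κ ρ i with κ i
... | true  = λ _ → inj₁ refl
... | false = inj₂

is-one : ℤ → Bool
is-one (+ 1) = true
is-one _     = false

is-one-sound : ∀ z → is-one z ≡ true → z ≡ 1ℤ
is-one-sound (+ 1) _ = refl

raised : Point → CoordSet
raised t i = is-one (coord t i)

-- The number of coordinates outside κ, which bounds the length of the closure process.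
outside : Bool → ℕ
outside true  = 0
outside false = 1

missing : CoordSet → ℕ
missing κ = outside (κ x̂) ℕ.+ outside (κ ŷ) ℕ.+ outside (κ ẑ)

outside-∨-≤ : ∀ a b → outside (a ∨ b) ℕ.≤ outside a
outside-∨-≤ true  _     = z≤n
outside-∨-≤ false true  = z≤n
outside-∨-≤ false false = ℕP.≤-refl

outside-∨-< : ∀ {a b} → a ≡ false → b ≡ true → outside (a ∨ b) ℕ.< outside a
outside-∨-< refl refl = s≤s z≤n

missing-decreases : ∀ κ ρ i → κ i ≡ false → ρ i ≡ true → missing (κ ∪ ρ) ℕ.< missing κ
missing-decreases κ ρ x̂ new∉κ new∈ρ =
  ℕP.+-mono-<-≤ (ℕP.+-mono-<-≤ (outside-∨-< new∉κ new∈ρ) (outside-∨-≤ (κ ŷ) (ρ ŷ))) (outside-∨-≤ (κ ẑ) (ρ ẑ))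
missing-decreases κ ρ ŷ new∉κ new∈ρ =
  ℕP.+-mono-<-≤ (ℕP.+-mono-≤-< (outside-∨-≤ (κ x̂) (ρ x̂)) (outside-∨-< new∉κ new∈ρ)) (outside-∨-≤ (κ ẑ) (ρ ẑ))
missing-decreases κ ρ ẑ new∉κ new∈ρ =
  ℕP.+-mono-≤-< (ℕP.+-mono-≤ (outside-∨-≤ (κ x̂) (ρ x̂)) (outside-∨-≤ (κ ŷ) (ρ ŷ))) (outside-∨-< new∉κ new∈ρ)

-- Closed sets of unbounded coordinates: the necessary conditions.

module Unboundedness (S : List Point) (steps : All IsStep S) where
  open Walks S

  Unbounded : CoordSet → Set
  Unbounded κ = ∀ M → Σ ℕ³ λ v → Reachable (toPoint v) × (∀ i → κ i ≡ true → M ℕ.≤ v i)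

  -- The step t lowers only coordinates of κ, so it can be repeated from far out in κ.
  Enabled : CoordSet → Point → Set
  Enabled κ t = ∀ i → Lowers t i → κ i ≡ true

  pump : ∀ {κ t} → t ∈ S → Enabled κ t → ∀ n M v → Reachable (toPoint v)
       → (∀ i → κ i ≡ true → n ℕ.+ M ℕ.≤ v i)
       → Σ ℕ³ λ v′ → Reachable (toPoint v′) × (∀ i → κ i ≡ true → M ℕ.≤ v′ i)
                                           × (∀ i → Raises t i → n ℕ.≤ v′ i)
  pump t∈S enabled zero M v reach large = v , reach , large , λ _ _ → z≤n
  pump {κ} {t} t∈S enabled (suc n) M v reach large
    with pump t∈S enabled n (suc M) v reach (λ i i∈κ → subst (ℕ._≤ v i) (sym (ℕP.+-suc n M)) (large i i∈κ))
  ... | v₁ , reach₁ , large₁ , raised₁ = move st v₁ , reach-move reach₁ t∈S st positive , large′ , raised′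
    where
    st : IsStep t
    st = All.lookup steps t∈S
    positive : ∀ i → Lowers t i → 1 ℕ.≤ v₁ i
    positive i down = ℕP.≤-trans (s≤s z≤n) (large₁ i (enabled i down))
    large′ : ∀ i → κ i ≡ true → M ℕ.≤ move st v₁ i
    large′ i i∈κ = ℕP.≤-trans (ℕP.pred-mono-≤ (large₁ i i∈κ)) (add-unit-≥ (v₁ i) (step-units st i))
    raised′ : ∀ i → Raises t i → suc n ℕ.≤ move st v₁ i
    raised′ i up = subst (suc n ℕ.≤_) (sym (add-unit-one (v₁ i) (step-units st i) up)) (s≤s (raised₁ i up))

  unbounded-∪ : ∀ {κ t} → Unbounded κ → t ∈ S → Enabled κ t → Unbounded (κ ∪ raised t)
  unbounded-∪ {κ} {t} unbounded t∈S enabled M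
    with unbounded (M ℕ.+ M)
  ... | v , reach , large with pump t∈S enabled M M v reach large
  ...   | v′ , reach′ , large′ , raised′ =
    v′ , reach′ , λ i i∈ → [ large′ i , (λ up → raised′ i (is-one-sound (coord t i) up)) ]′
                              (∪-member κ (raised t) i i∈)

  Closed : CoordSet → Set
  Closed κ = ∀ t → t ∈ S → Enabled κ t → ∀ i → Raises t i → κ i ≡ true

  Expands : CoordSet → Point → Set
  Expands κ t = Enabled κ t × Σ (Fin 3) λ i → Raises t i × (κ i ≡ false)

  expands? : ∀ κ → Decidable (Expands κ)
  expands? κ t = FinP.all? (λ i → (coord t i ℤ.≟ -1ℤ) →-dec (κ i Bool.≟ true))
                 ×-dec FinP.any? (λ i → (coord t i ℤ.≟ 1ℤ) ×-dec (κ i Bool.≟ false))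

  -- Add raised coordinates of enabled steps until κ is closed; each round adds a
  -- missing coordinate, so fuel n > missing κ suffices.
  close : ∀ n κ → missing κ ℕ.< n → Unbounded κ → Σ CoordSet λ κ′ → Unbounded κ′ × Closed κ′
  close (suc n) κ fuel unbounded with search (expands? κ) S
  ... | inj₁ (t , t∈S , enabled , i , up , i∉κ) =
    close n (κ ∪ raised t)
          (ℕP.<-≤-trans (missing-decreases κ (raised t) i i∉κ (cong is-one up)) (ℕP.≤-pred fuel))
          (unbounded-∪ unbounded t∈S enabled)
  ... | inj₂ none = κ , unbounded , λ t t∈S enabled i up → BoolP.¬-not λ i∉κ → none t t∈S (enabled , i , up , i∉κ)

  -- There is a closed set of unbounded coordinates: close up from κ = ∅, which is
  -- unbounded because the empty walk reaches the origin.
  closed-unbounded : Σ CoordSet λ κ → Unbounded κ × Closed κ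
  closed-unbounded = close 4 (λ _ → false) (s≤s (s≤s (s≤s (s≤s z≤n))))
                           (λ _ → (λ _ → 0) , ([] , [] , toPoint-inOctant (λ _ → 0) ∷ [] , refl) , λ _ ())

  module Closed-unbounded {κ : CoordSet} (unbounded : Unbounded κ) (closed : Closed κ) where

    step-of : ∀ {t} → t ∈ S → IsStep t
    step-of t∈S = All.lookup steps t∈S

    raises-outside : ∀ {t a} → t ∈ S → Raises t a → κ a ≡ false
                   → Σ (Fin 3) λ k → Lowers t k × (κ k ≡ false)
    raises-outside {t} {a} t∈S up a∉κ with FinP.any? (λ k → (coord t k ℤ.≟ -1ℤ) ×-dec (κ k Bool.≟ false))
    ... | yes found = found
    ... | no none   = ⊥-elim (false≢true a∉κ (closed t t∈S enabled a up))
      where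
      enabled : Enabled κ t
      enabled k down = BoolP.¬-not λ k∉κ → none (k , down , k∉κ)

    supported : ∀ {t} → t ∈ S → (∀ i → ¬ Lowers t i) → ∀ i → κ i ≡ false → coord t i ≡ 0ℤ
    supported {t} t∈S no-down i i∉κ = unit-zero (step-units (step-of t∈S) i) (no-down i) no-up
      where
      no-up : ¬ Raises t i
      no-up up with raises-outside t∈S up i∉κ
      ... | k , down , _ = no-down k down

    seed : ∀ j → κ j ≡ true → ∃ λ t → t ∈ S × (∀ i → ¬ Lowers t i)
    seed j j∈κ with unbounded 1
    ... | v , reach , large = leaves-origin reach away
      where
      away : toPoint v ≢ origin
      away at-origin = ℕP.<⇒≱ (large j j∈κ) (ℕP.≤-reflexive (ℤP.+-injective vj≡0))
        where
        vj≡0 : + v j ≡ + 0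
        vj≡0 = trans (sym (coord-toPoint v j)) (trans (cong (λ p → coord p j) at-origin) (coord-origin j))

    Blocked : Point → Set
    Blocked t = Σ (Fin 3) λ a → Lowers t a × (κ a ≡ false)

    blocked? : Decidable Blocked
    blocked? t = FinP.any? λ a → (coord t a ℤ.≟ -1ℤ) ×-dec (κ a Bool.≟ false)

    -- If no step is blocked, every step can be taken from a reachable point that is ≥ 1 on κ.
    all-used : (∀ t → t ∈ S → ¬ Blocked t) → ∀ s → s ∈ S → ¬ Unused S s
    all-used none s s∈S with unbounded 1
    ... | v , reach , large =
      used reach s∈S (subst InOctant (sym (move-⊕ st v positive)) (toPoint-inOctant (move st v)))
      where
      st : IsStep s
      st = step-of s∈S
      positive : ∀ i → Lowers s i → 1 ℕ.≤ v i
      positive i down = large i (BoolP.¬-not λ i∉κ → none s s∈S (i , down , i∉κ))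

    outside-xy : ∀ σ → κ (σ ⟨$⟩ʳ ẑ) ≡ true → ∀ k → κ k ≡ false → (k ≡ σ ⟨$⟩ʳ x̂) ⊎ (k ≡ σ ⟨$⟩ʳ ŷ)
    outside-xy σ z∈κ k k∉κ with permute-cover σ k
    ... | inj₁ k≡x         = inj₁ k≡x
    ... | inj₂ (inj₁ k≡y)  = inj₂ k≡y
    ... | inj₂ (inj₂ refl) = ⊥-elim (false≢true k∉κ z∈κ)

    raise⇒lower : ∀ {s} → s ∈ S → ∀ b c → (∀ k → κ k ≡ false → (k ≡ b) ⊎ (k ≡ c))
                → κ b ≡ false → Raises s b → Lowers s c
    raise⇒lower s∈S b c outside b∉κ up with raises-outside s∈S up b∉κ
    ... | k , down , k∉κ with outside k k∉κ
    ...   | inj₁ refl = ⊥-elim (-1≢1 (trans (sym down) up))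
    ...   | inj₂ refl = down

    case-B : (∀ i → κ i ≡ false) → ∃ (λ t → t ∈ S) → CondB S
    case-B all-outside some-step = some-step , negative
      where
      negative : ∀ t → t ∈ S → HasNegCoord t
      negative t t∈S with FinP.any? (λ i → coord t i ℤ.≟ -1ℤ)
      ... | yes (i , down) = HasNegCoord-at i (subst (_< 0ℤ) (sym down) -1<0)
      ... | no no-down = ⊥-elim (step-nonzero (step-of t∈S) (point-ext t (vanishes x̂) (vanishes ŷ) (vanishes ẑ)))
        where
        vanishes : ∀ i → coord t i ≡ 0ℤ
        vanishes i = supported t∈S (λ k down → no-down (k , down)) i (all-outside i)

    case-A : ∀ σ → κ (σ ⟨$⟩ʳ ŷ) ≡ true → κ (σ ⟨$⟩ʳ ẑ) ≡ true
           → ∃ (λ t → t ∈ S × Blocked t) → CondAx (map (permute σ) S)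
    case-A σ y∈κ z∈κ (t , t∈S , a , down , a∉κ) =
      (permute σ t , ∈-map⁺ (permute σ) t∈S , subst (Lowers t) (only-x a∉κ) down) ,
      ∀-map⁺ (permute σ) no-raise
      where
      only-x : ∀ {k} → κ k ≡ false → k ≡ σ ⟨$⟩ʳ x̂
      only-x {k} k∉κ with outside-xy σ z∈κ k k∉κ
      ... | inj₁ k≡x  = k≡x
      ... | inj₂ refl = ⊥-elim (false≢true k∉κ y∈κ)
      no-raise : ∀ s → s ∈ S → coord s (σ ⟨$⟩ʳ x̂) ≢ 1ℤ
      no-raise s s∈S up with raises-outside s∈S up (subst (λ k → κ k ≡ false) (only-x a∉κ) a∉κ)
      ... | k , down′ , k∉κ with only-x k∉κ
      ...   | refl = -1≢1 (trans (sym down′) up)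

    case-C : ∀ σ → κ (σ ⟨$⟩ʳ ẑ) ≡ true → κ (σ ⟨$⟩ʳ x̂) ≡ false → κ (σ ⟨$⟩ʳ ŷ) ≡ false
           → ∃ (λ t → t ∈ S × Blocked t) → CondCz (map (permute σ) S)
    case-C σ z∈κ x∉κ y∉κ (t , t∈S , a , down , a∉κ) = e-z∈σS , ∀-map⁺ (permute σ) balanced , off-axis
      where
      -- The seed step is e_{σ(z)}: it lowers nothing and is supported on κ.
      e-z∈σS : (0ℤ , 0ℤ , 1ℤ) ∈ map (permute σ) S
      e-z∈σS with seed (σ ⟨$⟩ʳ ẑ) z∈κ
      ... | t₀ , t₀∈S , no-down =
        subst (_∈ map (permute σ) S) (point-ext (permute σ t₀) x₀ y₀ z₁) (∈-map⁺ (permute σ) t₀∈S)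
        where
        x₀ : coord t₀ (σ ⟨$⟩ʳ x̂) ≡ 0ℤ
        x₀ = supported t₀∈S no-down (σ ⟨$⟩ʳ x̂) x∉κ
        y₀ : coord t₀ (σ ⟨$⟩ʳ ŷ) ≡ 0ℤ
        y₀ = supported t₀∈S no-down (σ ⟨$⟩ʳ ŷ) y∉κ
        z₁ : coord t₀ (σ ⟨$⟩ʳ ẑ) ≡ 1ℤ
        z₁ = unit-one (step-units (step-of t₀∈S) (σ ⟨$⟩ʳ ẑ)) (no-down (σ ⟨$⟩ʳ ẑ)) λ z₀ →
               step-nonzero (permute-step σ (step-of t₀∈S)) (point-ext (permute σ t₀) x₀ y₀ z₀)

      balanced : ∀ s → s ∈ S → coord s (σ ⟨$⟩ʳ x̂) ℤ.+ coord s (σ ⟨$⟩ʳ ŷ) ≤ 0ℤ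
      balanced s s∈S =
        unit-pair-sum (step-units (step-of s∈S) (σ ⟨$⟩ʳ x̂)) (step-units (step-of s∈S) (σ ⟨$⟩ʳ ŷ))
          (raise⇒lower s∈S _ _ (outside-xy σ z∈κ) x∉κ)
          (raise⇒lower s∈S _ _ (λ k k∉κ → swap (outside-xy σ z∈κ k k∉κ)) y∉κ)

      -- The blocked step lowers σ(x) or σ(y), so it is off the z-axis.
      off-axis : ¬ (∀ s → s ∈ map (permute σ) S → (s ≡ (0ℤ , 0ℤ , 1ℤ)) ⊎ (s ≡ (0ℤ , 0ℤ , -1ℤ)))
      off-axis on-axis with on-axis-xy (on-axis (permute σ t) (∈-map⁺ (permute σ) t∈S)) | outside-xy σ z∈κ a a∉κ
      ... | x₀ , _ | inj₁ refl = -1≢0 (trans (sym down) x₀)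
      ... | _ , y₀ | inj₂ refl = -1≢0 (trans (sym down) y₀)

    permuted : ∀ σ → CondAx (map (permute σ) S) ⊎ CondCz (map (permute σ) S) → Conditions S
    permuted σ c = inj₂ (inj₂ (inj₂ (σ , c)))

    blocked-conditions : ∃ (λ t → t ∈ S × Blocked t) → Conditions S
    blocked-conditions b@(t , t∈S , a , _ , a∉κ) with κ x̂ in x | κ ŷ in y | κ ẑ in z
    ... | true  | true  | true  = ⊥-elim (false≢true a∉κ (full a))
      where
      full : ∀ i → κ i ≡ true
      full x̂ = x
      full ŷ = y
      full ẑ = z
    ... | false | true  | true  = permuted Perm.id (inj₁ (case-A Perm.id y z b))
    ... | true  | false | true  = permuted (transpose x̂ ŷ) (inj₁ (case-A (transpose x̂ ŷ) x z b))
    ... | true  | true  | false = permuted (transpose x̂ ẑ) (inj₁ (case-A (transpose x̂ ẑ) y x b))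
    ... | true  | false | false = permuted (transpose x̂ ẑ) (inj₂ (case-C (transpose x̂ ẑ) x z y b))
    ... | false | true  | false = permuted (transpose ŷ ẑ) (inj₂ (case-C (transpose ŷ ẑ) y x z b))
    ... | false | false | true  = permuted Perm.id (inj₂ (case-C Perm.id z x y b))
    ... | false | false | false = inj₂ (inj₁ (case-B (λ { x̂ → x ; ŷ → y ; ẑ → z }) (t , t∈S)))

    classify : Conditions S ⊎ (∀ s → s ∈ S → ¬ Unused S s)
    classify with search blocked? S
    ... | inj₁ b    = inj₁ (blocked-conditions b)
    ... | inj₂ none = inj₂ (all-used none)


lemma2p4 : (S : List Point) → All IsStep S →
    (ContainsUnused S ⇔ (CondAx S ⊎ CondB S ⊎ CondCz S ⊎ CondD S))
    × (CondAx S → ∀ s → s ∈ S → xc s ≡ -1ℤ → Unused S s)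
    × (CondB S → ∀ s → s ∈ S → Unused S s)
    × (CondCz S → ∀ s → s ∈ S → (xc s < 0ℤ) ⊎ (yc s < 0ℤ) → Unused S s)
lemma2p4 S steps =
  mk⇔ unused⇒conditions (conditions⇒unused steps) ,
  (λ (_ , no-raise) s _ s-1 → axUnused steps x̂ no-raise s s-1) ,
  (λ (_ , negative) s s∈S → bUnused negative s s∈S) ,
  (λ (_ , balanced , _) s _ s<0 → czUnused x̂ ŷ balanced s s<0)
  where
  open Unboundedness S steps

  -- An unused step forces a condition: otherwise, by the analysis of a closed set
  -- of unbounded coordinates, every step would be used.
  unused⇒conditions : ContainsUnused S → Conditions S
  unused⇒conditions (s , s∈S , unused) with closed-unbounded
  ... | κ , unbounded , closed with Closed-unbounded.classify unbounded closed
  ...   | inj₁ conditions = conditions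
  ...   | inj₂ all-used   = ⊥-elim (all-used s s∈S unused)
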